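{- Let $u_*$ be a well-typed t-closed e-term of the ptq-calculus such that $u_*\to^* u_*'$. Let $t_*$ be a well-typed t-closed t-term. If either (1) $t_*$ is not an abstraction of the form $\lambda x.u''_*$, or (2) the reduction $u_*\to^*u_*'$ does not contract any redex of the form $*;\lambda k.u''$, then $t_*\cdot u_*\to^* t_*\cdot u_*'$.
   Context: The ptq-calculus. Intuitionistic types: $A::=X\mid A\to A$ ($X$ base types); for each $A$ there are types $A^{\mathsf p}$ (proof), $A^{\mathsf t}$ (test), $A^{\mathsf q}$. Terms: p-variables $x,y,\dots$; a t-variable $k$; a constant $*$. p-terms $p::=x\mid\lambda\langle x,k\rangle.u\mid\lambda k.u$; t-terms $t::=*\mid k\mid\langle p,t\rangle\mid\lambda x.u$; q-terms $q::=\overline{\lambda}k.u$; e-terms $u::=t;p\mid q\,t$. $\lambda\langle x,k\rangle$ binds $x,k$; $\lambda k$ and $\overline\lambda k$ bind $k$; $\lambda x$ binds $x$. Terms are taken modulo $\alpha$-conversion; substitution is capture-avoiding. A term is t-closed if it has no free t-variable; t-closed t-/e-terms are written with a subscript $*$, and for a term $u$ with $k$ free, $u_*$ denotes $u[*/k]$. Typing: environments are $\Gamma$ or $\Gamma\rhd\delta$, with $\Gamma$ a set $x_1:A_1^{\mathsf p},\dots,x_n:A_n^{\mathsf p}$ of distinct p-variables and $\delta$ either $k:A^{\mathsf t}$ or $*:A^{\mathsf t}$. Rules: $\Gamma,x:A^{\mathsf p}\vdash x:A^{\mathsf p}$; $\Gamma\rhd k:A^{\mathsf t}\vdash k:A^{\mathsf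 t}$; $\Gamma\rhd *:A^{\mathsf t}\vdash *:A^{\mathsf t}$; from $\Gamma,x:A^{\mathsf p}\rhd k:B^{\mathsf t}\vdash u$ infer $\Gamma\vdash\lambda\langle x,k\rangle.u:(A\to B)^{\mathsf p}$; from $\Gamma\vdash p:A^{\mathsf p}$ and $\Gamma\rhd\delta\vdash t:B^{\mathsf t}$ infer $\Gamma\rhd\delta\vdash\langle p,t\rangle:(A\to B)^{\mathsf t}$; from $\Gamma\rhd k:A^{\mathsf t}\vdash u$ infer $\Gamma\vdash\lambda k.u:A^{\mathsf p}$; from $\Gamma,x:A^{\mathsf p}\rhd\delta\vdash u$ infer $\Gamma\rhd\delta\vdash\lambda x.u:A^{\mathsf t}$; from $\Gamma\rhd k:A^{\mathsf t}\vdash u$ infer $\Gamma\vdash\overline\lambda k.u:A^{\mathsf q}$; from $\Gamma\vdash p:A^{\mathsf p}$ and $\Gamma\rhd\delta\vdash t:A^{\mathsf t}$ infer $\Gamma\rhd\delta\vdash t;p$; from $\Gamma\vdash q:A^{\mathsf q}$ and $\Gamma\rhd\delta\vdash t:A^{\mathsf t}$ infer $\Gamma\rhd\delta\vdash q\,t$. Reduction (on t-closed e-terms, at top level only; no reduction under binders or inside pairs): $*;\lambda k.u\to u[*/k]$; $\langle p,t_*\rangle;\lambda k.u\to u[\langle p,t_*\rangle/k]$; $\langle p,t_*\rangle;\lambda\langle x,k\rangle.u\to u[p/x,t_*/k]$; $(\lambda x.u_*);p\to u_*[p/x]$; $(\overline\lambda k.u)\,t_*\to u[t_*/k]$. $\to^*$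 is the reflexive–transitive closure. Composition: for t-closed t-terms $t_*$ and a t-closed t-term or e-term $a_*$, $t_*\cdot a_*:=a_*[t_*/*]$ (replace $*$ by $t_*$). -}

module Defs where

open import Data.Nat using (ℕ; zero; suc)
open import Data.Fin using (Fin; zero; suc)
open import Data.Vec using (Vec; _∷_; lookup)
open import Data.Product using (Σ; _×_; _,_)
open import Data.Unit using (⊤)
open import Data.Empty using (⊥)
open import Relation.Binary.PropositionalEquality using (_≡_)
open import Relation.Nullary using (¬_)

data Ty : Set where
  base : ℕ → Ty
  _⇒_  : Ty → Ty → Ty

infixr 20 _⇒_

-- Syntax, modulo α-conversion.
-- p-variables: well-scoped de Bruijn indices (terms indexed by the number
-- n of p-variables in scope).
-- There is a single t-variable k; every binder of k (λ⟨x,k⟩, λk, λ̄k)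
-- rebinds that one name, so an occurrence 'kv' always refers to the
-- innermost enclosing k-binder (this is exactly α-equivalence for a single
-- name).

data P (n : ℕ) : Set
data T (n : ℕ) : Set
data Q (n : ℕ) : Set
data E (n : ℕ) : Set

data P n where
  var   : Fin n → P n
  lamXK : E (suc n) → P n
  lamK  : E n → P n

data T n where
  star : T n
  kv   : T n
  pair : P n → T n → T n
  lamX : E (suc n) → T n

data Q n where
  lamKbar : E n → Q n

data E n where
  seq : T n → P n → E n
  app : Q n → T n → E n

-- t-closedness (no free occurrence of k).  p- and q-terms never have a
-- free k (every k inside them is bound), so only t- and e-terms matter.

closedT : ∀ {n} → T n → Set
closedE : ∀ {n} → E n → Set

closedT star       = ⊤
closedT kv         = ⊥
closedT (pair p t) = closedT t
closedT (lamX u)   = closedE u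

closedE (seq t p) = closedT t
closedE (app q t) = closedT t

IsLamX : ∀ {n} → T n → Set
IsLamX star       = ⊥
IsLamX kv         = ⊥
IsLamX (pair p t) = ⊥
IsLamX (lamX u)   = ⊤

Ren : ℕ → ℕ → Set
Ren n m = Fin n → Fin m

ext : ∀ {n m} → Ren n m → Ren (suc n) (suc m)
ext ρ zero    = zero
ext ρ (suc i) = suc (ρ i)

renP : ∀ {n m} → Ren n m → P n → P m
renT : ∀ {n m} → Ren n m → T n → T m
renQ : ∀ {n m} → Ren n m → Q n → Q m
renE : ∀ {n m} → Ren n m → E n → E m

renP ρ (var i)   = var (ρ i)
renP ρ (lamXK u) = lamXK (renE (ext ρ) u)
renP ρ (lamK u)  = lamK (renE ρ u)

renT ρ star       = star
renT ρ kv         = kv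
renT ρ (pair p t) = pair (renP ρ p) (renT ρ t)
renT ρ (lamX u)   = lamX (renE (ext ρ) u)

renQ ρ (lamKbar u) = lamKbar (renE ρ u)

renE ρ (seq t p) = seq (renT ρ t) (renP ρ p)
renE ρ (app q t) = app (renQ ρ q) (renT ρ t)

-- Capture-avoiding simultaneous substitution of p-terms for p-variables.
-- (p-terms have no free k, so no t-variable capture can arise.)

Sub : ℕ → ℕ → Set
Sub n m = Fin n → P m

exts : ∀ {n m} → Sub n m → Sub (suc n) (suc m)
exts σ zero    = var zero
exts σ (suc i) = renP suc (σ i)

subP : ∀ {n m} → Sub n m → P n → P m
subT : ∀ {n m} → Sub n m → T n → T m
subQ : ∀ {n m} → Sub n m → Q n → Q m
subE : ∀ {n m} → Sub n m → E n → E m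

subP σ (var i)   = σ i
subP σ (lamXK u) = lamXK (subE (exts σ) u)
subP σ (lamK u)  = lamK (subE σ u)

subT σ star       = star
subT σ kv         = kv
subT σ (pair p t) = pair (subP σ p) (subT σ t)
subT σ (lamX u)   = lamX (subE (exts σ) u)

subQ σ (lamKbar u) = lamKbar (subE σ u)

subE σ (seq t p) = seq (subT σ t) (subP σ p)
subE σ (app q t) = app (subQ σ q) (subT σ t)

single : ∀ {n} → P n → Sub (suc n) n
single p zero    = p
single p (suc i) = var i

-- Substitution of a t-term for the free t-variable k:  a[t/k].
-- Free k's only occur outside p- and q-subterms, so p/q parts are unchanged.

substKT : ∀ {n} → T n → T n → T n
substKE : ∀ {n} → T n → E n → E n

substKT s star       = star
substKT s kv         = s
substKT s (pair p t) = pair p (substKT s t)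
substKT s (lamX u)   = lamX (substKE (renT suc s) u)

substKE s (seq t p) = seq (substKT s t) p
substKE s (app q t) = app q (substKT s t)

-- Used below only for t-closed t, so no k can be captured.

starP : ∀ {n} → T n → P n → P n
starT : ∀ {n} → T n → T n → T n
starQ : ∀ {n} → T n → Q n → Q n
starE : ∀ {n} → T n → E n → E n

starP s (var i)   = var i
starP s (lamXK u) = lamXK (starE (renT suc s) u)
starP s (lamK u)  = lamK (starE s u)

starT s star       = s
starT s kv         = kv
starT s (pair p t) = pair (starP s p) (starT s t)
starT s (lamX u)   = lamX (starE (renT suc s) u)

starQ s (lamKbar u) = lamKbar (starE s u)

starE s (seq t p) = seq (starT s t) (starP s p)
starE s (app q t) = app (starQ s q) (starT s t)

_·E_ : ∀ {n} → T n → E n → E n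
t ·E u = starE t u

_·T_ : ∀ {n} → T n → T n → T n
t ·T a = starT t a

data Δ : Set where
  kδ    : Ty → Δ
  starδ : Ty → Δ

data _⊢p_∶_ {n} (Γ : Vec Ty n) : P n → Ty → Set
data _▹_⊢t_∶_ {n} (Γ : Vec Ty n) : Δ → T n → Ty → Set
data _⊢q_∶_ {n} (Γ : Vec Ty n) : Q n → Ty → Set
data _▹_⊢e_ {n} (Γ : Vec Ty n) : Δ → E n → Set

data _⊢p_∶_ {n} Γ where
  ty-var   : ∀ i → Γ ⊢p var i ∶ lookup Γ i
  ty-lamXK : ∀ {A B u} → (A ∷ Γ) ▹ kδ B ⊢e u → Γ ⊢p lamXK u ∶ (A ⇒ B)
  ty-lamK  : ∀ {A u} → Γ ▹ kδ A ⊢e u → Γ ⊢p lamK u ∶ A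

data _▹_⊢t_∶_ {n} Γ where
  ty-k    : ∀ {A} → Γ ▹ kδ A ⊢t kv ∶ A
  ty-star : ∀ {A} → Γ ▹ starδ A ⊢t star ∶ A
  ty-pair : ∀ {δ A B p t} → Γ ⊢p p ∶ A → Γ ▹ δ ⊢t t ∶ B
          → Γ ▹ δ ⊢t pair p t ∶ (A ⇒ B)
  ty-lamX : ∀ {δ A u} → (A ∷ Γ) ▹ δ ⊢e u → Γ ▹ δ ⊢t lamX u ∶ A

data _⊢q_∶_ {n} Γ where
  ty-lamKbar : ∀ {A u} → Γ ▹ kδ A ⊢e u → Γ ⊢q lamKbar u ∶ A

data _▹_⊢e_ {n} Γ where
  ty-seq : ∀ {δ A t p} → Γ ⊢p p ∶ A → Γ ▹ δ ⊢t t ∶ A → Γ ▹ δ ⊢e seq t p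
  ty-app : ∀ {δ A q t} → Γ ⊢q q ∶ A → Γ ▹ δ ⊢t t ∶ A → Γ ▹ δ ⊢e app q t

WellTypedE : ∀ {n} → E n → Set
WellTypedE {n} u = Σ (Vec Ty n) λ Γ → Σ Δ λ δ → Γ ▹ δ ⊢e u

WellTypedT : ∀ {n} → T n → Set
WellTypedT {n} t = Σ (Vec Ty n) λ Γ → Σ Δ λ δ → Σ Ty λ A → Γ ▹ δ ⊢t t ∶ A

-- Reduction (top level only, on t-closed e-terms), labelled by the rule.

data Rule : Set where
  R-star-λk   : Rule
  R-pair-λk   : Rule
  R-pair-λxk  : Rule
  R-λx        : Rule
  R-λ̄k        : Rule

data _⟶⟨_⟩_ {n} : E n → Rule → E n → Set where
  red-star-λk  : ∀ {u} → seq star (lamK u) ⟶⟨ R-star-λk ⟩ substKE star u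
  red-pair-λk  : ∀ {p t u} → closedT t →
                 seq (pair p t) (lamK u) ⟶⟨ R-pair-λk ⟩ substKE (pair p t) u
  red-pair-λxk : ∀ {p t u} → closedT t →
                 seq (pair p t) (lamXK u) ⟶⟨ R-pair-λxk ⟩ substKE t (subE (single p) u)
  red-λx       : ∀ {u p} → closedE u →
                 seq (lamX u) p ⟶⟨ R-λx ⟩ subE (single p) u
  red-λ̄k       : ∀ {u t} → closedT t →
                 app (lamKbar u) t ⟶⟨ R-λ̄k ⟩ substKE t u

data _⟶*_ {n} : E n → E n → Set where
  done : ∀ {u} → u ⟶* u
  step : ∀ {u v w r} → u ⟶⟨ r ⟩ v → v ⟶* w → u ⟶* w

NoStarRedex : ∀ {n} {u v : E n} → u ⟶* v → Set
NoStarRedex done = ⊤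
NoStarRedex (step {r = r} s rs) = (¬ (r ≡ R-star-λk)) × NoStarRedex rs

module Submission where

-- Composition t · u replaces * by t, and every reduction rule is an instance of a
-- substitution: star replacement commutes with substituting p-terms for p-variables
-- and, for t-closed t, with substituting for k. Hence each redex of u becomes a
-- redex of t · u with the same contractum up to composition. The only exception is
-- *;λk.v, which becomes t;λk.v: for t = * or t = ⟨p,t'⟩ this is again a redex, but
-- for t = λx.u'' it is stuck.

open import Defs
open import Data.Nat using (ℕ; suc)
open import Data.Fin using (Fin; zero; suc)
open import Data.Product using (Σ; _,_)
open import Data.Sum using (_⊎_; inj₁; inj₂)
open import Data.Unit using (tt)
open import Data.Empty using (⊥-elim)
open import Relation.Nullary using (¬_)
open import Relation.Binary.PropositionalEquality
  using (_≡_; refl; sym; trans; cong; cong₂; subst; module ≡-Reasoning)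

private
  variable
    n m l : ℕ

mutual
  renP-fusion : {ρ : Ren m l} {ρ′ : Ren n m} {ρ″ : Ren n l} →
                (∀ i → ρ (ρ′ i) ≡ ρ″ i) → ∀ a → renP ρ (renP ρ′ a) ≡ renP ρ″ a
  renP-fusion h (var i)   = cong var (h i)
  renP-fusion h (lamXK u) = cong lamXK (renE-fusion (ext-fusion h) u)
  renP-fusion h (lamK u)  = cong lamK (renE-fusion h u)

  renT-fusion : {ρ : Ren m l} {ρ′ : Ren n m} {ρ″ : Ren n l} →
                (∀ i → ρ (ρ′ i) ≡ ρ″ i) → ∀ a → renT ρ (renT ρ′ a) ≡ renT ρ″ a
  renT-fusion h star       = refl
  renT-fusion h kv         = refl
  renT-fusion h (pair p t) = cong₂ pair (renP-fusion h p) (renT-fusion h t)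
  renT-fusion h (lamX u)   = cong lamX (renE-fusion (ext-fusion h) u)

  renE-fusion : {ρ : Ren m l} {ρ′ : Ren n m} {ρ″ : Ren n l} →
                (∀ i → ρ (ρ′ i) ≡ ρ″ i) → ∀ a → renE ρ (renE ρ′ a) ≡ renE ρ″ a
  renE-fusion h (seq t p)           = cong₂ seq (renT-fusion h t) (renP-fusion h p)
  renE-fusion h (app (lamKbar u) t) =
    cong₂ app (cong lamKbar (renE-fusion h u)) (renT-fusion h t)

  ext-fusion : {ρ : Ren m l} {ρ′ : Ren n m} {ρ″ : Ren n l} →
               (∀ i → ρ (ρ′ i) ≡ ρ″ i) → ∀ i → ext ρ (ext ρ′ i) ≡ ext ρ″ i
  ext-fusion h zero    = refl
  ext-fusion h (suc i) = cong suc (h i)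

renP-ext-suc : (ρ : Ren n m) (a : P n) → renP (ext ρ) (renP suc a) ≡ renP suc (renP ρ a)
renP-ext-suc ρ a = trans (renP-fusion (λ _ → refl) a) (sym (renP-fusion (λ _ → refl) a))

renT-ext-suc : (ρ : Ren n m) (a : T n) → renT (ext ρ) (renT suc a) ≡ renT suc (renT ρ a)
renT-ext-suc ρ a = trans (renT-fusion (λ _ → refl) a) (sym (renT-fusion (λ _ → refl) a))

mutual
  subP-cong : {σ σ′ : Sub n m} → (∀ i → σ i ≡ σ′ i) → ∀ a → subP σ a ≡ subP σ′ a
  subP-cong h (var i)   = h i
  subP-cong h (lamXK u) = cong lamXK (subE-cong (exts-cong h) u)
  subP-cong h (lamK u)  = cong lamK (subE-cong h u)

  subT-cong : {σ σ′ : Sub n m} → (∀ i → σ i ≡ σ′ i) → ∀ a → subT σ a ≡ subT σ′ a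
  subT-cong h star       = refl
  subT-cong h kv         = refl
  subT-cong h (pair p t) = cong₂ pair (subP-cong h p) (subT-cong h t)
  subT-cong h (lamX u)   = cong lamX (subE-cong (exts-cong h) u)

  subE-cong : {σ σ′ : Sub n m} → (∀ i → σ i ≡ σ′ i) → ∀ a → subE σ a ≡ subE σ′ a
  subE-cong h (seq t p)           = cong₂ seq (subT-cong h t) (subP-cong h p)
  subE-cong h (app (lamKbar u) t) =
    cong₂ app (cong lamKbar (subE-cong h u)) (subT-cong h t)

  exts-cong : {σ σ′ : Sub n m} → (∀ i → σ i ≡ σ′ i) → ∀ i → exts σ i ≡ exts σ′ i
  exts-cong h zero    = refl
  exts-cong h (suc i) = cong (renP suc) (h i)

exts-var : ∀ (i : Fin (suc n)) → exts var i ≡ var i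
exts-var zero    = refl
exts-var (suc i) = refl

mutual
  subP-id : (a : P n) → subP var a ≡ a
  subP-id (var i)   = refl
  subP-id (lamXK u) = cong lamXK (trans (subE-cong exts-var u) (subE-id u))
  subP-id (lamK u)  = cong lamK (subE-id u)

  subT-id : (a : T n) → subT var a ≡ a
  subT-id star       = refl
  subT-id kv         = refl
  subT-id (pair p a) = cong₂ pair (subP-id p) (subT-id a)
  subT-id (lamX u)   = cong lamX (trans (subE-cong exts-var u) (subE-id u))

  subE-id : (a : E n) → subE var a ≡ a
  subE-id (seq a p)           = cong₂ seq (subT-id a) (subP-id p)
  subE-id (app (lamKbar u) a) = cong₂ app (cong lamKbar (subE-id u)) (subT-id a)

mutual
  subP-renP : {σ : Sub m l} {ρ : Ren n m} {σ′ : Sub n l} →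
              (∀ i → σ (ρ i) ≡ σ′ i) → ∀ a → subP σ (renP ρ a) ≡ subP σ′ a
  subP-renP h (var i)   = h i
  subP-renP h (lamXK u) = cong lamXK (subE-renE (exts-ext h) u)
  subP-renP h (lamK u)  = cong lamK (subE-renE h u)

  subT-renT : {σ : Sub m l} {ρ : Ren n m} {σ′ : Sub n l} →
              (∀ i → σ (ρ i) ≡ σ′ i) → ∀ a → subT σ (renT ρ a) ≡ subT σ′ a
  subT-renT h star       = refl
  subT-renT h kv         = refl
  subT-renT h (pair p t) = cong₂ pair (subP-renP h p) (subT-renT h t)
  subT-renT h (lamX u)   = cong lamX (subE-renE (exts-ext h) u)

  subE-renE : {σ : Sub m l} {ρ : Ren n m} {σ′ : Sub n l} →
              (∀ i → σ (ρ i) ≡ σ′ i) → ∀ a → subE σ (renE ρ a) ≡ subE σ′ a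
  subE-renE h (seq t p)           = cong₂ seq (subT-renT h t) (subP-renP h p)
  subE-renE h (app (lamKbar u) t) =
    cong₂ app (cong lamKbar (subE-renE h u)) (subT-renT h t)

  exts-ext : {σ : Sub m l} {ρ : Ren n m} {σ′ : Sub n l} →
             (∀ i → σ (ρ i) ≡ σ′ i) → ∀ i → exts σ (ext ρ i) ≡ exts σ′ i
  exts-ext h zero    = refl
  exts-ext h (suc i) = cong (renP suc) (h i)

mutual
  renP-subP : {ρ : Ren m l} {σ : Sub n m} {σ′ : Sub n l} →
              (∀ i → renP ρ (σ i) ≡ σ′ i) → ∀ a → renP ρ (subP σ a) ≡ subP σ′ a
  renP-subP h (var i)   = h i
  renP-subP h (lamXK u) = cong lamXK (renE-subE (ext-exts h) u)
  renP-subP h (lamK u)  = cong lamK (renE-subE h u)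

  renT-subT : {ρ : Ren m l} {σ : Sub n m} {σ′ : Sub n l} →
              (∀ i → renP ρ (σ i) ≡ σ′ i) → ∀ a → renT ρ (subT σ a) ≡ subT σ′ a
  renT-subT h star       = refl
  renT-subT h kv         = refl
  renT-subT h (pair p t) = cong₂ pair (renP-subP h p) (renT-subT h t)
  renT-subT h (lamX u)   = cong lamX (renE-subE (ext-exts h) u)

  renE-subE : {ρ : Ren m l} {σ : Sub n m} {σ′ : Sub n l} →
              (∀ i → renP ρ (σ i) ≡ σ′ i) → ∀ a → renE ρ (subE σ a) ≡ subE σ′ a
  renE-subE h (seq t p)           = cong₂ seq (renT-subT h t) (renP-subP h p)
  renE-subE h (app (lamKbar u) t) =
    cong₂ app (cong lamKbar (renE-subE h u)) (renT-subT h t)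

  ext-exts : {ρ : Ren m l} {σ : Sub n m} {σ′ : Sub n l} →
             (∀ i → renP ρ (σ i) ≡ σ′ i) →
             ∀ i → renP (ext ρ) (exts σ i) ≡ exts σ′ i
  ext-exts h zero            = refl
  ext-exts {ρ = ρ} {σ} h (suc i) = trans (renP-ext-suc ρ (σ i)) (cong (renP suc) (h i))

renT-suc-ext : {ρ : Ren n m} {s : T n} {s′ : T m} → renT ρ s ≡ s′ →
               renT (ext ρ) (renT suc s) ≡ renT suc s′
renT-suc-ext {ρ = ρ} {s} h = trans (renT-ext-suc ρ s) (cong (renT suc) h)

mutual
  starP-renP : {ρ : Ren n m} {s : T n} {s′ : T m} → renT ρ s ≡ s′ →
               ∀ a → starP s′ (renP ρ a) ≡ renP ρ (starP s a)
  starP-renP h (var i)   = refl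
  starP-renP h (lamXK u) = cong lamXK (starE-renE (renT-suc-ext h) u)
  starP-renP h (lamK u)  = cong lamK (starE-renE h u)

  starT-renT : {ρ : Ren n m} {s : T n} {s′ : T m} → renT ρ s ≡ s′ →
               ∀ a → starT s′ (renT ρ a) ≡ renT ρ (starT s a)
  starT-renT h star       = sym h
  starT-renT h kv         = refl
  starT-renT h (pair p t) = cong₂ pair (starP-renP h p) (starT-renT h t)
  starT-renT h (lamX u)   = cong lamX (starE-renE (renT-suc-ext h) u)

  starE-renE : {ρ : Ren n m} {s : T n} {s′ : T m} → renT ρ s ≡ s′ →
               ∀ a → starE s′ (renE ρ a) ≡ renE ρ (starE s a)
  starE-renE h (seq t p)           = cong₂ seq (starT-renT h t) (starP-renP h p)
  starE-renE h (app (lamKbar u) t) =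
    cong₂ app (cong lamKbar (starE-renE h u)) (starT-renT h t)

starP-exts : (σ : Sub n m) {s′ : T m} →
             ∀ i → starP (renT suc s′) (exts σ i) ≡ exts (λ j → starP s′ (σ j)) i
starP-exts σ zero    = refl
starP-exts σ (suc i) = starP-renP refl (σ i)

subT-suc-exts : {σ : Sub n m} {s : T n} {s′ : T m} →
                subT (λ i → starP s′ (σ i)) s ≡ s′ →
                subT (λ i → starP (renT suc s′) (exts σ i)) (renT suc s) ≡ renT suc s′
subT-suc-exts {σ = σ} {s} h = begin
  subT (λ i → starP _ (exts σ i)) (renT suc s)  ≡⟨ subT-renT (λ _ → refl) s ⟩
  subT (λ i → starP _ (renP suc (σ i))) s      ≡⟨ subT-cong (λ i → starP-renP refl (σ i)) s ⟩
  subT (λ i → renP suc (starP _ (σ i))) s      ≡⟨ sym (renT-subT (λ _ → refl) s) ⟩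
  renT suc (subT (λ i → starP _ (σ i)) s)      ≡⟨ cong (renT suc) h ⟩
  renT suc _                                    ∎
  where open ≡-Reasoning

-- On the right * becomes s, which the substitution then hits, so it must map s to s′.

mutual
  starP-subP : {σ : Sub n m} {s : T n} {s′ : T m} →
               subT (λ i → starP s′ (σ i)) s ≡ s′ →
               ∀ a → starP s′ (subP σ a) ≡ subP (λ i → starP s′ (σ i)) (starP s a)
  starP-subP h (var i)   = refl
  starP-subP {σ = σ} h (lamXK u) =
    cong lamXK (trans (starE-subE (subT-suc-exts h) u) (subE-cong (starP-exts σ) _))
  starP-subP h (lamK u)  = cong lamK (starE-subE h u)

  starT-subT : {σ : Sub n m} {s : T n} {s′ : T m} →
               subT (λ i → starP s′ (σ i)) s ≡ s′ →
               ∀ a → starT s′ (subT σ a) ≡ subT (λ i → starP s′ (σ i)) (starT s a)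
  starT-subT h star       = sym h
  starT-subT h kv         = refl
  starT-subT h (pair p t) = cong₂ pair (starP-subP h p) (starT-subT h t)
  starT-subT {σ = σ} h (lamX u) =
    cong lamX (trans (starE-subE (subT-suc-exts h) u) (subE-cong (starP-exts σ) _))

  starE-subE : {σ : Sub n m} {s : T n} {s′ : T m} →
               subT (λ i → starP s′ (σ i)) s ≡ s′ →
               ∀ a → starE s′ (subE σ a) ≡ subE (λ i → starP s′ (σ i)) (starE s a)
  starE-subE h (seq t p)           = cong₂ seq (starT-subT h t) (starP-subP h p)
  starE-subE h (app (lamKbar u) t) =
    cong₂ app (cong lamKbar (starE-subE h u)) (starT-subT h t)

starE-single : (t : T n) (p : P n) (u : E (suc n)) →
               starE t (subE (single p) u) ≡ subE (single (starP t p)) (starE (renT suc t) u)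
starE-single t p u =
  trans (starE-subE t-preimage u) (subE-cong single-star (starE (renT suc t) u))
  where
  t-preimage : subT (λ i → starP t (single p i)) (renT suc t) ≡ t
  t-preimage = trans (subT-renT (λ _ → refl) t) (subT-id t)

  single-star : ∀ i → starP t (single p i) ≡ single (starP t p) i
  single-star zero    = refl
  single-star (suc i) = refl

mutual
  renT-closed : (ρ : Ren n m) (a : T n) → closedT a → closedT (renT ρ a)
  renT-closed ρ star       c = c
  renT-closed ρ (pair p t) c = renT-closed ρ t c
  renT-closed ρ (lamX u)   c = renE-closed (ext ρ) u c

  renE-closed : (ρ : Ren n m) (a : E n) → closedE a → closedE (renE ρ a)
  renE-closed ρ (seq t p) c = renT-closed ρ t c
  renE-closed ρ (app q t) c = renT-closed ρ t c

mutual
  starT-closed : {s : T n} → closedT s → (a : T n) → closedT a → closedT (starT s a)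
  starT-closed cs star       c = cs
  starT-closed cs (pair p t) c = starT-closed cs t c
  starT-closed {s = s} cs (lamX u) c = starE-closed (renT-closed suc s cs) u c

  starE-closed : {s : T n} → closedT s → (a : E n) → closedE a → closedE (starE s a)
  starE-closed cs (seq t p) c = starT-closed cs t c
  starE-closed cs (app q t) c = starT-closed cs t c

mutual
  substKT-closed : (s a : T n) → closedT a → substKT s a ≡ a
  substKT-closed s star       c = refl
  substKT-closed s (pair p t) c = cong (pair p) (substKT-closed s t c)
  substKT-closed s (lamX u)   c = cong lamX (substKE-closed (renT suc s) u c)

  substKE-closed : (s : T n) (a : E n) → closedE a → substKE s a ≡ a
  substKE-closed s (seq t p) c = cong (λ t′ → seq t′ p) (substKT-closed s t c)
  substKE-closed s (app q t) c = cong (app q) (substKT-closed s t c)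

-- On the right the substitution for k also reaches the copies of t put in place of *,
-- so t must be t-closed.

mutual
  starT-substKT : {t : T n} → closedT t →
                  ∀ s a → starT t (substKT s a) ≡ substKT (starT t s) (starT t a)
  starT-substKT {t = t} c s star = sym (substKT-closed _ t c)
  starT-substKT c s kv           = refl
  starT-substKT {t = t} c s (pair p a) = cong (pair (starP t p)) (starT-substKT c s a)
  starT-substKT {t = t} c s (lamX u) = cong lamX (trans
    (starE-substKE (renT-closed suc t c) (renT suc s) u)
    (cong (λ s′ → substKE s′ (starE (renT suc t) u)) (starT-renT refl s)))

  starE-substKE : {t : T n} → closedT t →
                  ∀ s a → starE t (substKE s a) ≡ substKE (starT t s) (starE t a)
  starE-substKE {t = t} c s (seq a p) =
    cong (λ a′ → seq a′ (starP t p)) (starT-substKT c s a)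
  starE-substKE {t = t} c s (app q a) = cong (app (starQ t q)) (starT-substKT c s a)

⟶-resp-≡ : {u v w : E n} {r : Rule} → v ≡ w → u ⟶⟨ r ⟩ v → u ⟶⟨ r ⟩ w
⟶-resp-≡ {u = u} {r = r} = subst (u ⟶⟨ r ⟩_)

·-step : {t : T n} → closedT t → {u v : E n} {r : Rule} → u ⟶⟨ r ⟩ v →
         (r ≡ R-star-λk → ¬ IsLamX t) → Σ Rule λ r′ → (t ·E u) ⟶⟨ r′ ⟩ (t ·E v)
·-step {t = star} c (red-star-λk {u}) _ =
  R-star-λk , ⟶-resp-≡ (sym (starE-substKE c star u)) red-star-λk
·-step {t = pair p t′} c (red-star-λk {u}) _ =
  R-pair-λk , ⟶-resp-≡ (sym (starE-substKE c star u)) (red-pair-λk c)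
·-step {t = lamX _} c red-star-λk notLamX = ⊥-elim (notLamX refl tt)
·-step c (red-pair-λk {p} {t′} {u} ct′) _ =
  R-pair-λk , ⟶-resp-≡ (sym (starE-substKE c (pair p t′) u))
                         (red-pair-λk (starT-closed c t′ ct′))
·-step {t = t} c (red-pair-λxk {p} {t′} {u} ct′) _ =
  R-pair-λxk , ⟶-resp-≡ (sym (trans (starE-substKE c t′ (subE (single p) u))
                                     (cong (substKE (starT t t′)) (starE-single t p u))))
                          (red-pair-λxk (starT-closed c t′ ct′))
·-step {t = t} c (red-λx {u} {p} cu) _ =
  R-λx , ⟶-resp-≡ (sym (starE-single t p u))
                    (red-λx (starE-closed (renT-closed suc t c) u cu))
·-step c (red-λ̄k {u} {t′} ct′) _ =
  R-λ̄k , ⟶-resp-≡ (sym (starE-substKE c t′ u)) (red-λ̄k (starT-closed c t′ ct′))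

·-steps : {t : T n} → closedT t → {u u′ : E n} (r : u ⟶* u′) →
          (¬ IsLamX t) ⊎ NoStarRedex r → (t ·E u) ⟶* (t ·E u′)
·-steps c done _ = done
·-steps c (step s rs) (inj₁ notLamX) =
  let _ , s′ = ·-step c s (λ _ → notLamX) in step s′ (·-steps c rs (inj₁ notLamX))
·-steps c (step s rs) (inj₂ (notStar , noStar)) =
  let _ , s′ = ·-step c s (λ isStar → ⊥-elim (notStar isStar)) in
  step s′ (·-steps c rs (inj₂ noStar))

lemma1 : ∀ {n} (u u' : E n) (t : T n)
         → closedE u → WellTypedE u
         → closedT t → WellTypedT t
         → (r : u ⟶* u')
         → (¬ IsLamX t) ⊎ NoStarRedex r
         → (t ·E u) ⟶* (t ·E u')
lemma1 u u' t _ _ closed-t _ r side = ·-steps closed-t r side
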